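{- Let $\mathcal{H}$ be a pseudohalfplane hypergraph on $V$ with witnessing ABA-free hypergraph $\mathcal{F}$, and let $C$ be its set of extremal vertices with the circular order defined below. Then for every hyperedge $H\in\mathcal{H}$, the set $H\cap C$ is an interval of the circular order on $C$.
   Context: Let $V=\{v_1<v_2<\dots<v_n\}$ be a finite totally ordered set. A hypergraph $\mathcal{F}$ on $V$ is ABA-free if there are no two hyperedges $A,B\in\mathcal{F}$ and vertices $x<y<z$ with $x,z\in A\setminus B$ and $y\in B\setminus A$. Let $\bar{\mathcal{F}}=\{V\setminus F: F\in\mathcal{F}\}$. $\mathcal{H}$ is a pseudohalfplane hypergraph if $\mathcal{H}\subseteq\mathcal{F}\cup\bar{\mathcal{F}}$ for some ABA-free $\mathcal{F}$ on $V$; fix such an $\mathcal{F}$. Hyperedges of $\mathcal{H}$ in $\mathcal{F}$ are topsets, those in $\bar{\mathcal{F}}$ are bottomsets. A vertex $a$ is skippable in a hypergraph $\mathcal{G}$ on $V$ if some $A\in\mathcal{G}$ has $\min(A)<a<\max(A)$ and $a\notin A$, and unskippable otherwise. Topvertices are the unskippable vertices of $\mathcal{F}$, bottomvertices are the unskippable vertices of $\bar{\mathcal{F}}$; $v_1$ and $v_n$ are both. The set $C$ of extremal vertices is the set of topvertices together with the bottomvertices. Let $t_1=v_1<t_2<\dots<t_k=v_n$ be the topvertices and $b_1=v_1<b_2<\dots<b_l=v_n$ the bottomvertices (a vertex may be both). The circular order on $C$ is the cyclic sequence $(v_1,t_2,\dots,t_{k-1},v_n,b_{l-1},\dots,b_2)$;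 an interval is a set of cyclically consecutive elements of this sequence. -}

module Defs where

open import Data.Nat as ℕ using (ℕ; zero; suc)
open import Data.Fin using (Fin; toℕ; _<_; _<?_)
open import Data.Fin.Properties using (any?)
open import Data.Fin.Subset using (Subset; _∈_; _∉_; ∁)
open import Data.Fin.Subset.Properties using (_∈?_)
open import Data.List using (List; map; filter; _++_; reverse; take; drop)
open import Data.List.Relation.Unary.Any using (Any)
import Data.List.Relation.Unary.Any as Any
import Data.List.Membership.Propositional as LM
open import Data.Product using (Σ; ∃; _×_; _,_)
open import Data.Sum using (_⊎_)
open import Data.Vec using (allFin)
import Data.Vec as Vec
open import Data.Empty using (⊥)
open import Function.Bundles using (_⇔_)
open import Relation.Nullary using (Dec; ¬_; ¬?)
open import Relation.Nullary.Decidable using (_×-dec_)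

-- Vertices of V = {v_1 < ... < v_n} are  Fin n  (ordered by the usual order on Fin).
-- A hyperedge is a subset of V; a hypergraph is a finite list of hyperedges.

Hypergraph : ℕ → Set
Hypergraph n = List (Subset n)

_∈ₗ_ : ∀ {a} {A : Set a} → A → List A → Set a
_∈ₗ_ = LM._∈_

ABAFree : ∀ {n} → Hypergraph n → Set
ABAFree {n} F =
  ∀ (A B : Subset n) → A ∈ₗ F → B ∈ₗ F →
  ∀ (x y z : Fin n) → x < y → y < z →
  x ∈ A → x ∉ B → z ∈ A → z ∉ B → y ∈ B → y ∉ A → ⊥

complementHG : ∀ {n} → Hypergraph n → Hypergraph n
complementHG = map ∁

IsPseudohalfplaneWitness : ∀ {n} → Hypergraph n → Hypergraph n → Set
IsPseudohalfplaneWitness 𝓗 𝓕 =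
  ABAFree 𝓕 × (∀ H → H ∈ₗ 𝓗 → (H ∈ₗ 𝓕 ⊎ H ∈ₗ complementHG 𝓕))

-- a is skippable in G: some A ∈ G with min A < a < max A and a ∉ A
-- (i.e. some element of A below a and some element of A above a).
SkippableIn : ∀ {n} → Hypergraph n → Fin n → Set
SkippableIn {n} G a =
  Any (λ A → (∃ λ (x : Fin n) → x < a × x ∈ A)
           × (∃ λ (z : Fin n) → a < z × z ∈ A)
           × a ∉ A) G

skippable? : ∀ {n} (G : Hypergraph n) (a : Fin n) → Dec (SkippableIn G a)
skippable? {n} G a = Any.any? (λ A →
    any? (λ x → (x <? a) ×-dec (x ∈? A))
    ×-dec any? (λ z → (a <? z) ×-dec (z ∈? A))
    ×-dec ¬? (a ∈? A)) G

Unskippable : ∀ {n} → Hypergraph n → Fin n → Set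
Unskippable G a = ¬ SkippableIn G a

vertices : ∀ n → List (Fin n)
vertices n = Vec.toList (allFin n)

topvertices : ∀ {n} → Hypergraph n → List (Fin n)
topvertices {n} F = filter (λ v → ¬? (skippable? F v)) (vertices n)

innerBottomvertices : ∀ {n} → Hypergraph n → List (Fin n)
innerBottomvertices {n} F =
  filter (λ v → ¬? (skippable? (complementHG F) v)
                ×-dec (0 ℕ.<? toℕ v) ×-dec (suc (toℕ v) ℕ.<? n))
         (vertices n)

circularSeq : ∀ {n} → Hypergraph n → List (Fin n)
circularSeq F = topvertices F ++ reverse (innerBottomvertices F)

Extremal : ∀ {n} → Hypergraph n → Fin n → Set
Extremal F v = v ∈ₗ circularSeq F

rotate : ∀ {a} {A : Set a} → ℕ → List A → List A
rotate k xs = drop k xs ++ take k xs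

-- S ⊆ C is an interval of the circular order: S is the set of elements of
-- some cyclically consecutive block of the cyclic sequence
IsCircularInterval : ∀ {n} → (Fin n → Set) → List (Fin n) → Set
IsCircularInterval {n} S c =
  Σ ℕ λ k → Σ ℕ λ ℓ → ∀ (v : Fin n) → S v ⇔ (v ∈ₗ take ℓ (rotate k c))

module Submission where

-- A topset H contains,
-- with any two vertices, every topvertex between them (topvertices are
-- unskippable in 𝓕), and its complement does the same for bottomvertices.  So H
-- is convex along the tops, V ∖ H is convex along the bottoms, and a case split
-- on whether H contains v_1 and v_n shows that H meets the concatenated cyclic
-- sequence in one (possibly wrapping) block.  Bottomsets follow by reading the
-- cycle backwards.

open import Defs
open import Level using (0ℓ)
open import Data.Nat using (ℕ; zero; suc; z≤n)
open import Data.Fin using (Fin; _<_; fromℕ)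
import Data.Fin.Properties as Fin
open import Data.Fin.Subset using (Subset; _∈_; _∉_)
import Data.Fin.Subset as Subset
open import Data.Fin.Subset.Properties using (_∈?_; x∈∁p⇒x∉p; x∉∁p⇒x∈p; x∉p⇒x∈∁p; x∈p⇒x∉∁p)
open import Data.List using (List; []; _∷_; _++_; reverse; take; drop; length; tabulate)
open import Data.List.Properties using (reverse-++; reverse-involutive; ++-assoc; take++drop≡id)
open import Data.List.Relation.Unary.All as All using (All; []; _∷_)
open import Data.List.Relation.Unary.All.Properties using (++⁺)
open import Data.List.Relation.Unary.AllPairs using (AllPairs; []; _∷_)
import Data.List.Relation.Unary.AllPairs.Properties as AllPairs
open import Data.List.Relation.Unary.Any using (here; there)
open import Data.List.Relation.Unary.Any.Properties using (reverse⁻)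
open import Data.List.Membership.Propositional using (lose)
open import Data.List.Membership.Propositional.Properties using (∈-map⁺; ∈-map⁻; ∈-++⁺ˡ; ∈-++⁺ʳ; ∈-++⁻; ∈-filter⁻)
open import Data.List.Relation.Binary.Permutation.Propositional using (_↭_; ↭-sym; ↭-reflexive; ↭-trans)
open import Data.List.Relation.Binary.Permutation.Propositional.Properties using (++-comm; ∈-resp-↭)
import Data.Vec as Vec
open import Data.Product using (_×_; _,_; proj₁; proj₂)
open import Data.Sum using (_⊎_; inj₁; inj₂)
open import Data.Empty using (⊥-elim)
open import Function using (_∘_; id)
open import Function.Bundles using (mk⇔)
open import Relation.Nullary using (yes; no; ¬_; ¬?)
open import Relation.Nullary.Negation using (contradiction)
open import Relation.Nullary.Decidable using (decidable-stable)
open import Relation.Unary using (Pred; Decidable; ∁; _⊆_; _≐_)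
open import Relation.Binary.PropositionalEquality using (_≡_; _≢_; refl; sym; trans; cong; cong₂; subst; module ≡-Reasoning)

module _ {A : Set} where

  record Sandwich (Out In : Pred A 0ℓ) (xs : List A) : Set where
    constructor sandwich
    field
      left middle right : List A
      split     : xs ≡ left ++ middle ++ right
      left-out  : All Out left
      middle-in : All In middle
      right-out : All Out right

  record Cut (Below Above : Pred A 0ℓ) (xs : List A) : Set where
    constructor cut
    field
      lower upper : List A
      split       : xs ≡ lower ++ upper
      lower-below : All Below lower
      upper-above : All Above upper

  -- The elements satisfying Q form one block of the cyclic sequence xs: either
  -- a block inside xs, or one that wraps around its end.
  CyclicBlock : Pred A 0ℓ → List A → Set
  CyclicBlock Q xs = Sandwich (∁ Q) Q xs ⊎ Sandwich Q (∁ Q) xs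

  All-reverse : ∀ {P : Pred A 0ℓ} {xs} → All P xs → All P (reverse xs)
  All-reverse ps = All.tabulate (All.lookup ps ∘ reverse⁻)

  reverse-++³ : ∀ (xs ys zs : List A) → reverse (xs ++ ys ++ zs) ≡ reverse zs ++ reverse ys ++ reverse xs
  reverse-++³ xs ys zs = begin
    reverse (xs ++ ys ++ zs)                ≡⟨ reverse-++ xs (ys ++ zs) ⟩
    reverse (ys ++ zs) ++ reverse xs        ≡⟨ cong (_++ reverse xs) (reverse-++ ys zs) ⟩
    (reverse zs ++ reverse ys) ++ reverse xs ≡⟨ ++-assoc (reverse zs) (reverse ys) (reverse xs) ⟩
    reverse zs ++ reverse ys ++ reverse xs  ∎
    where open ≡-Reasoning

  reverse-++-reverse : ∀ (xs ys : List A) → reverse (xs ++ reverse ys) ≡ ys ++ reverse xs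
  reverse-++-reverse xs ys = begin
    reverse (xs ++ reverse ys)          ≡⟨ reverse-++ xs (reverse ys) ⟩
    reverse (reverse ys) ++ reverse xs  ≡⟨ cong (_++ reverse xs) (reverse-involutive ys) ⟩
    ys ++ reverse xs                    ∎
    where open ≡-Reasoning

  Sandwich-reverse : ∀ {Out In : Pred A 0ℓ} {xs} → Sandwich Out In xs → Sandwich Out In (reverse xs)
  Sandwich-reverse (sandwich L M R refl oL iM oR) =
    sandwich (reverse R) (reverse M) (reverse L) (reverse-++³ L M R)
             (All-reverse oR) (All-reverse iM) (All-reverse oL)

  Sandwich-map : ∀ {Out Out′ In In′ : Pred A 0ℓ} {xs} → Out ⊆ Out′ → In ⊆ In′ →
                 Sandwich Out In xs → Sandwich Out′ In′ xs
  Sandwich-map f g (sandwich L M R eq oL iM oR) =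
    sandwich L M R eq (All.map f oL) (All.map g iM) (All.map f oR)

  CyclicBlock-swap : ∀ {Q : Pred A 0ℓ} xs ys → CyclicBlock Q (ys ++ reverse xs) → CyclicBlock Q (xs ++ reverse ys)
  CyclicBlock-swap {Q} xs ys b =
    subst (CyclicBlock Q) (reverse-++-reverse ys xs) (Data.Sum.map Sandwich-reverse Sandwich-reverse b)

  CyclicBlock-∁ : ∀ {Q : Pred A 0ℓ} {xs} → Decidable Q → CyclicBlock (∁ Q) xs → CyclicBlock Q xs
  CyclicBlock-∁ Q? (inj₁ s) = inj₂ (Sandwich-map (decidable-stable (Q? _)) id s)
  CyclicBlock-∁ Q? (inj₂ s) = inj₁ (Sandwich-map id (decidable-stable (Q? _)) s)

  CyclicBlock-dual : ∀ {Q : Pred A 0ℓ} → Decidable Q → ∀ xs ys →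
    CyclicBlock (∁ Q) (ys ++ reverse xs) → CyclicBlock Q (xs ++ reverse ys)
  CyclicBlock-dual Q? xs ys = CyclicBlock-∁ Q? ∘ CyclicBlock-swap xs ys

  take-length-++ : ∀ (xs ys : List A) → take (length xs) (xs ++ ys) ≡ xs
  take-length-++ []       ys = refl
  take-length-++ (x ∷ xs) ys = cong (x ∷_) (take-length-++ xs ys)

  drop-length-++ : ∀ (xs ys : List A) → drop (length xs) (xs ++ ys) ≡ ys
  drop-length-++ []       ys = refl
  drop-length-++ (x ∷ xs) ys = drop-length-++ xs ys

  rotate-length-++ : ∀ (xs ys : List A) → rotate (length xs) (xs ++ ys) ≡ ys ++ xs
  rotate-length-++ xs ys = cong₂ _++_ (drop-length-++ xs ys) (take-length-++ xs ys)

  rotate-↭ : ∀ k (xs : List A) → rotate k xs ↭ xs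
  rotate-↭ k xs = ↭-trans (++-comm (drop k xs) (take k xs)) (↭-reflexive (take++drop≡id k xs))

module _ {n : ℕ} {Q : Pred (Fin n) 0ℓ} where

  circularInterval-of-rotation : ∀ k c (I O : List (Fin n)) → rotate k c ≡ I ++ O →
    All Q I → All (∁ Q) O → IsCircularInterval (λ v → Q v × v ∈ₗ c) c
  circularInterval-of-rotation k c I O eq qI nO = k , length I , λ v → mk⇔ to from
    where
    window : take (length I) (rotate k c) ≡ I
    window = trans (cong (take (length I)) eq) (take-length-++ I O)

    to : ∀ {v} → Q v × v ∈ₗ c → v ∈ₗ take (length I) (rotate k c)
    to (q , v∈c) with ∈-++⁻ I (subst (_ ∈ₗ_) eq (∈-resp-↭ (↭-sym (rotate-↭ k c)) v∈c))
    ... | inj₁ v∈I = subst (_ ∈ₗ_) (sym window) v∈I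
    ... | inj₂ v∈O = contradiction q (All.lookup nO v∈O)

    from : ∀ {v} → v ∈ₗ take (length I) (rotate k c) → Q v × v ∈ₗ c
    from {v} v∈w = All.lookup qI v∈I , ∈-resp-↭ (rotate-↭ k c) (subst (_ ∈ₗ_) (sym eq) (∈-++⁺ˡ v∈I))
      where
      v∈I : v ∈ₗ I
      v∈I = subst (_ ∈ₗ_) window v∈w

  cyclicBlock⇒circularInterval : ∀ {c} → CyclicBlock Q c → IsCircularInterval (λ v → Q v × v ∈ₗ c) c
  cyclicBlock⇒circularInterval (inj₁ (sandwich L M R refl oL iM oR)) =
    circularInterval-of-rotation (length L) _ M (R ++ L) eq iM (++⁺ oR oL)
    where
    eq : rotate (length L) (L ++ M ++ R) ≡ M ++ R ++ L
    eq = begin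
      rotate (length L) (L ++ M ++ R) ≡⟨ rotate-length-++ L (M ++ R) ⟩
      (M ++ R) ++ L                   ≡⟨ ++-assoc M R L ⟩
      M ++ R ++ L                     ∎
      where open ≡-Reasoning
  cyclicBlock⇒circularInterval (inj₂ (sandwich L M R refl iL oM iR)) =
    circularInterval-of-rotation (length (L ++ M)) _ (R ++ L) M eq (++⁺ iR iL) oM
    where
    eq : rotate (length (L ++ M)) (L ++ M ++ R) ≡ (R ++ L) ++ M
    eq = begin
      rotate (length (L ++ M)) (L ++ M ++ R)   ≡⟨ cong (rotate (length (L ++ M))) (sym (++-assoc L M R)) ⟩
      rotate (length (L ++ M)) ((L ++ M) ++ R) ≡⟨ rotate-length-++ (L ++ M) R ⟩
      R ++ L ++ M                              ≡⟨ sym (++-assoc R L M) ⟩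
      (R ++ L) ++ M                            ∎
      where open ≡-Reasoning

module _ {n : ℕ} where

  ConvexOn : Pred (Fin n) 0ℓ → List (Fin n) → Set
  ConvexOn R xs = ∀ {a y c} → y ∈ₗ xs → a < y → y < c → R a → R c → R y

  UpwardClosedOn : Pred (Fin n) 0ℓ → List (Fin n) → Set
  UpwardClosedOn R xs = ∀ {x y} → x ∈ₗ xs → y ∈ₗ xs → x < y → R x → R y

  ConvexOn-resp-≐ : ∀ {P R : Pred (Fin n) 0ℓ} {xs} → P ≐ R → ConvexOn P xs → ConvexOn R xs
  ConvexOn-resp-≐ (P⊆R , R⊆P) convex y∈xs a<y y<c ra rc = P⊆R (convex y∈xs a<y y<c (R⊆P ra) (R⊆P rc))

  ConvexOn-¬¬ : ∀ {R : Pred (Fin n) 0ℓ} {xs} → Decidable R → ConvexOn R xs → ConvexOn (∁ (∁ R)) xs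
  ConvexOn-¬¬ R? = ConvexOn-resp-≐ (contradiction , decidable-stable (R? _))

  module _ {R : Pred (Fin n) 0ℓ} (R? : Decidable R) where

    upwardClosed-cut : ∀ {xs} → AllPairs _<_ xs → UpwardClosedOn R xs → Cut (∁ R) R xs
    upwardClosed-cut {[]}     []              _  = cut [] [] refl [] []
    upwardClosed-cut {x ∷ xs} (x<xs ∷ sorted) up with R? x
    ... | yes rx = cut [] (x ∷ xs) refl []
                       (rx ∷ All.tabulate (λ y∈xs → up (here refl) (there y∈xs) (All.lookup x<xs y∈xs) rx))
    ... | no ¬rx with upwardClosed-cut sorted (λ x∈ y∈ → up (there x∈) (there y∈))
    ...   | cut S P refl ¬rS rP = cut (x ∷ S) P refl (¬rx ∷ ¬rS) rP

    convex-sandwich : ∀ {xs} → AllPairs _<_ xs → ConvexOn R xs → Sandwich (∁ R) R xs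
    convex-sandwich {[]}     []              _      = sandwich [] [] [] refl [] [] []
    convex-sandwich {x ∷ xs} (x<xs ∷ sorted) convex
      with convex-sandwich sorted (convex ∘ there) | R? x
    ... | sandwich L M Rt refl ¬rL rM ¬rR | no ¬rx = sandwich (x ∷ L) M Rt refl (¬rx ∷ ¬rL) rM ¬rR
    ... | sandwich L [] Rt refl ¬rL rM ¬rR | yes rx = sandwich [] (x ∷ []) (L ++ Rt) refl [] (rx ∷ []) (++⁺ ¬rL ¬rR)
    ... | sandwich [] M Rt refl ¬rL rM ¬rR | yes rx = sandwich [] (x ∷ M) Rt refl [] (rx ∷ rM) ¬rR
    -- x < l < b with R x and R b but ¬ R l contradicts convexity.
    ... | sandwich (l ∷ L) (b ∷ M) Rt refl (¬rl ∷ _) (rb ∷ _) _ | yes rx with x<xs | sorted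
    ...   | x<l ∷ _ | l<rest ∷ _ =
      contradiction (convex (there (here refl)) x<l (All.lookup l<rest (∈-++⁺ʳ L (here refl))) rx rb) ¬rl

module _ {m : ℕ} {R : Pred (Fin (suc m)) 0ℓ} {xs : List (Fin (suc m))} where

  private
    first last : Fin (suc m)
    first = Fin.zero
    last  = fromℕ m

    first< : ∀ {y} → y ≢ first → first < y
    first< y≢first = Fin.≤∧≢⇒< z≤n (y≢first ∘ sym)

    <last : ∀ {y} → y ≢ last → y < last
    <last {y} = Fin.≤∧≢⇒< (Fin.≤fromℕ y)

  convex-from-last : R last → ConvexOn R xs → ∀ {a y} → y ∈ₗ xs → a < y → R a → R y
  convex-from-last r-last convex {y = y} y∈xs a<y ra with y Fin.≟ last
  ... | yes refl    = r-last
  ... | no y≢last   = convex y∈xs a<y (<last y≢last) ra r-last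

  convex-from-first : R first → ConvexOn R xs → ∀ {y c} → y ∈ₗ xs → y < c → R c → R y
  convex-from-first r-first convex {y = y} y∈xs y<c rc with y Fin.≟ first
  ... | yes refl    = r-first
  ... | no y≢first  = convex y∈xs (first< y≢first) y<c r-first rc

  convex-All : R first → R last → ConvexOn R xs → All R xs
  convex-All r-first r-last convex = All.tabulate R-at
    where
    R-at : ∀ {y} → y ∈ₗ xs → R y
    R-at {y} y∈xs with y Fin.≟ first
    ... | yes refl    = r-first
    ... | no y≢first  = convex-from-last r-last convex y∈xs (first< y≢first) r-first

module _ {m : ℕ} {Q : Pred (Fin (suc m)) 0ℓ} (Q? : Decidable Q) {X Y : List (Fin (suc m))}
         (X-sorted : AllPairs _<_ X) (Y-sorted : AllPairs _<_ Y) where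

  sandwich-when-ends-outside : ¬ Q Fin.zero → ¬ Q (fromℕ m) → ConvexOn Q X → ConvexOn (∁ Q) Y →
    Sandwich (∁ Q) Q (X ++ reverse Y)
  sandwich-when-ends-outside ¬q-first ¬q-last X-convex Y-convex
    with convex-sandwich Q? X-sorted X-convex
  ... | sandwich L M R refl ¬qL qM ¬qR =
    sandwich L M (R ++ reverse Y) eq ¬qL qM (++⁺ ¬qR (All-reverse (convex-All ¬q-first ¬q-last Y-convex)))
    where
    eq : (L ++ M ++ R) ++ reverse Y ≡ L ++ M ++ R ++ reverse Y
    eq = begin
      (L ++ M ++ R) ++ reverse Y   ≡⟨ ++-assoc L (M ++ R) (reverse Y) ⟩
      L ++ (M ++ R) ++ reverse Y   ≡⟨ cong (L ++_) (++-assoc M R (reverse Y)) ⟩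
      L ++ M ++ R ++ reverse Y     ∎
      where open ≡-Reasoning

  sandwich-when-only-last-inside : ¬ Q Fin.zero → Q (fromℕ m) → ConvexOn Q X → ConvexOn (∁ Q) Y →
    Sandwich (∁ Q) Q (X ++ reverse Y)
  sandwich-when-only-last-inside ¬q-first q-last X-convex Y-convex
    with upwardClosed-cut Q? X-sorted (λ _ y∈X x<y → convex-from-last q-last X-convex y∈X x<y)
       | upwardClosed-cut Q? Y-sorted (λ x∈Y _ x<y qx →
           decidable-stable (Q? _) (λ ¬qy → convex-from-first ¬q-first Y-convex x∈Y x<y ¬qy qx))
  ... | cut S P refl ¬qS qP | cut S′ P′ refl ¬qS′ qP′ =
    sandwich S (P ++ reverse P′) (reverse S′) eq ¬qS (++⁺ qP (All-reverse qP′)) (All-reverse ¬qS′)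
    where
    eq : (S ++ P) ++ reverse (S′ ++ P′) ≡ S ++ (P ++ reverse P′) ++ reverse S′
    eq = begin
      (S ++ P) ++ reverse (S′ ++ P′)          ≡⟨ cong ((S ++ P) ++_) (reverse-++ S′ P′) ⟩
      (S ++ P) ++ reverse P′ ++ reverse S′    ≡⟨ ++-assoc S P _ ⟩
      S ++ P ++ reverse P′ ++ reverse S′      ≡⟨ cong (S ++_) (sym (++-assoc P (reverse P′) (reverse S′))) ⟩
      S ++ (P ++ reverse P′) ++ reverse S′    ∎
      where open ≡-Reasoning

-- Complementing Q and exchanging the two arcs (which reverses the cycle)
-- reduces the cases with v_1 ∈ Q to the ones with v_1 ∉ Q.
cyclicBlock : ∀ {m} {Q : Pred (Fin (suc m)) 0ℓ} → Decidable Q → ∀ {X Y} →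
  AllPairs _<_ X → AllPairs _<_ Y → ConvexOn Q X → ConvexOn (∁ Q) Y → CyclicBlock Q (X ++ reverse Y)
cyclicBlock {m} Q? {X} {Y} X-sorted Y-sorted X-convex Y-convex with Q? Fin.zero | Q? (fromℕ m)
... | no ¬q-first | no ¬q-last =
  inj₁ (sandwich-when-ends-outside Q? X-sorted Y-sorted ¬q-first ¬q-last X-convex Y-convex)
... | no ¬q-first | yes q-last =
  inj₁ (sandwich-when-only-last-inside Q? X-sorted Y-sorted ¬q-first q-last X-convex Y-convex)
... | yes q-first | no ¬q-last = CyclicBlock-dual Q? X Y (inj₁
  (sandwich-when-only-last-inside (¬? ∘ Q?) Y-sorted X-sorted
     (contradiction q-first) ¬q-last Y-convex (ConvexOn-¬¬ Q? X-convex)))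
... | yes q-first | yes q-last = CyclicBlock-dual Q? X Y (inj₁
  (sandwich-when-ends-outside (¬? ∘ Q?) Y-sorted X-sorted
     (contradiction q-first) (contradiction q-last) Y-convex (ConvexOn-¬¬ Q? X-convex)))

unskippable⇒convex : ∀ {n} {G : Hypergraph n} {K xs} → K ∈ₗ G →
  (∀ {v} → v ∈ₗ xs → Unskippable G v) → ConvexOn (_∈ K) xs
unskippable⇒convex {K = K} K∈G unskippable {a} {y} {c} y∈xs a<y y<c a∈K c∈K with y ∈? K
... | yes y∈K = y∈K
... | no  y∉K = ⊥-elim (unskippable y∈xs (lose K∈G ((a , a<y , a∈K) , (c , y<c , c∈K) , y∉K)))

∈∁≐∉ : ∀ {n} {K : Subset n} → (_∈ Subset.∁ K) ≐ (_∉ K)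
∈∁≐∉ = x∈∁p⇒x∉p , x∉p⇒x∈∁p

∈≐∉∁ : ∀ {n} {K : Subset n} → (_∈ K) ≐ (_∉ Subset.∁ K)
∈≐∉∁ = x∈p⇒x∉∁p , x∉∁p⇒x∈p

toList-tabulate : ∀ {A : Set} {k} (f : Fin k → A) → Vec.toList (Vec.tabulate f) ≡ tabulate f
toList-tabulate {k = zero}  f = refl
toList-tabulate {k = suc k} f = cong (f Fin.zero ∷_) (toList-tabulate (f ∘ Fin.suc))

vertices-sorted : ∀ n → AllPairs _<_ (vertices n)
vertices-sorted n = subst (AllPairs _<_) (sym (toList-tabulate id)) (AllPairs.tabulate⁺-< id)

module _ {n : ℕ} (𝓕 : Hypergraph n) where

  topvertices-sorted : AllPairs _<_ (topvertices 𝓕)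
  topvertices-sorted = AllPairs.filter⁺ _ (vertices-sorted n)

  innerBottomvertices-sorted : AllPairs _<_ (innerBottomvertices 𝓕)
  innerBottomvertices-sorted = AllPairs.filter⁺ _ (vertices-sorted n)

  topvertices-unskippable : ∀ {v} → v ∈ₗ topvertices 𝓕 → Unskippable 𝓕 v
  topvertices-unskippable v∈ = proj₂ (∈-filter⁻ _ {xs = vertices n} v∈)

  innerBottomvertices-unskippable : ∀ {v} → v ∈ₗ innerBottomvertices 𝓕 → Unskippable (complementHG 𝓕) v
  innerBottomvertices-unskippable v∈ = proj₁ (proj₂ (∈-filter⁻ _ {xs = vertices n} v∈))

mainTheorem16 : ∀ (n : ℕ) (𝓗 𝓕 : Hypergraph n) →
    IsPseudohalfplaneWitness 𝓗 𝓕 →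
    ∀ H → H ∈ₗ 𝓗 →
    IsCircularInterval (λ v → v ∈ H × Extremal 𝓕 v) (circularSeq 𝓕)
mainTheorem16 zero    _ _ _ _ _ = 0 , 0 , λ ()
mainTheorem16 (suc m) 𝓗 𝓕 (_ , 𝓗⊆𝓕∪𝓕̄) H H∈𝓗 = cyclicBlock⇒circularInterval (block (𝓗⊆𝓕∪𝓕̄ H H∈𝓗))
  where
  tops bottoms : List (Fin (suc m))
  tops    = topvertices 𝓕
  bottoms = innerBottomvertices 𝓕

  block : H ∈ₗ 𝓕 ⊎ H ∈ₗ complementHG 𝓕 → CyclicBlock (_∈ H) (tops ++ reverse bottoms)
  block (inj₁ H∈𝓕) =
    cyclicBlock (_∈? H) (topvertices-sorted 𝓕) (innerBottomvertices-sorted 𝓕)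
      (unskippable⇒convex H∈𝓕 (topvertices-unskippable 𝓕))
      (ConvexOn-resp-≐ ∈∁≐∉ (unskippable⇒convex (∈-map⁺ Subset.∁ H∈𝓕) (innerBottomvertices-unskippable 𝓕)))
  block (inj₂ H∈𝓕̄) with ∈-map⁻ Subset.∁ H∈𝓕̄
  ... | F , F∈𝓕 , refl = CyclicBlock-swap tops bottoms
    (cyclicBlock (_∈? H) (innerBottomvertices-sorted 𝓕) (topvertices-sorted 𝓕)
      (unskippable⇒convex H∈𝓕̄ (innerBottomvertices-unskippable 𝓕))
      (ConvexOn-resp-≐ ∈≐∉∁ (unskippable⇒convex F∈𝓕 (topvertices-unskippable 𝓕))))
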